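{- For all integers $k_1,k_2\geq1$ with $k:=k_1+k_2\geq4$ even, the following holds in $\mathcal{E}_k$: \[ \begin{aligned} \frac12\left(\binom{k_1+k_2}{k_2}-(-1)^{k_1}\right)G\begin{bmatrix}k\\0\end{bmatrix}=\;&\sum_{\substack{j=2\\ j\text{ even}}}^{k-2}\left(\binom{k-j-1}{k_1-1}+\binom{k-j-1}{k_2-1}-\delta_{j,k_1}\right)P\begin{bmatrix}j,k-j\\0,0\end{bmatrix}\\ &+\frac12\left(\binom{k-3}{k_1-1}+\binom{k-3}{k_2-1}+\delta_{k_1,1}+\delta_{k_2,1}\right)G\begin{bmatrix}k-1\\1\end{bmatrix}. \end{aligned} \]
   Context: Formal double Eisenstein space $\mathcal{E}_K$ ($K\geq1$): the $\mathbb{Q}$-vector space spanned by formal symbols $G\begin{bmatrix}k\\ d\end{bmatrix}$ ($k\geq1,d\geq0,k+d=K$), $G\begin{bmatrix}k_1,k_2\\ d_1,d_2\end{bmatrix}$, $P\begin{bmatrix}k_1,k_2\\ d_1,d_2\end{bmatrix}$ ($k_i\geq1,d_i\geq0$, $k_1+k_2+d_1+d_2=K$) modulo the relations, for all such indices: $P\begin{bmatrix}k_1,k_2\\ d_1,d_2\end{bmatrix}=G\begin{bmatrix}k_1,k_2\\ d_1,d_2\end{bmatrix}+G\begin{bmatrix}k_2,k_1\\ d_2,d_1\end{bmatrix}+G\begin{bmatrix}k_1+k_2\\ d_1+d_2\end{bmatrix}=\sum_{\substack{l_1+l_2=k_1+k_2,\ e_1+e_2=d_1+d_2\\ l_i\geq1,\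 e_i\geq0}}\left(\binom{l_1-1}{k_1-1}\binom{d_1}{e_1}(-1)^{d_1-e_1}+\binom{l_1-1}{k_2-1}\binom{d_2}{e_1}(-1)^{d_2-e_1}\right)G\begin{bmatrix}l_1,l_2\\ e_1,e_2\end{bmatrix}+\frac{d_1!d_2!}{(d_1+d_2+1)!}\binom{k_1+k_2-2}{k_1-1}G\begin{bmatrix}k_1+k_2-1\\ d_1+d_2+1\end{bmatrix}$. $\delta$ is the Kronecker delta. -}

module Defs where

open import Data.Bool using (Bool; true; false; _∧_; if_then_else_)
open import Data.Nat as ℕ using (ℕ; zero; suc; _∸_; _≡ᵇ_; _!; _%_; _≤_)
open import Data.Nat.Properties using (_!≢0)
open import Data.Nat.Combinatorics using (_C_)
open import Data.Nat.Divisibility using (_∣_)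
open import Data.Integer using (+_)
open import Data.Rational using (ℚ; 0ℚ; 1ℚ; _+_; _*_; _-_; -_; _/_)
open import Data.List using (List; []; _∷_; _++_; map; concatMap; upTo; filterᵇ; foldr)
open import Data.Product using (_×_; _,_; Σ; ∃)
open import Relation.Binary.PropositionalEquality using (_≡_)

ℕ→ℚ : ℕ → ℚ
ℕ→ℚ n = (+ n) / 1

sgn : ℕ → ℚ
sgn n = if n % 2 ≡ᵇ 0 then 1ℚ else - 1ℚ

δ : ℕ → ℕ → ℚ
δ m n = if m ≡ᵇ n then 1ℚ else 0ℚ

-- Formal generators:  G1 k d = G[k;d],  G2 k₁ k₂ d₁ d₂ = G[k₁,k₂;d₁,d₂],
-- P k₁ k₂ d₁ d₂ = P[k₁,k₂;d₁,d₂]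
data Gen : Set where
  G1 : ℕ → ℕ → Gen
  G2 : ℕ → ℕ → ℕ → ℕ → Gen
  P  : ℕ → ℕ → ℕ → ℕ → Gen

_==_ : Gen → Gen → Bool
G1 a b == G1 a' b' = (a ≡ᵇ a') ∧ (b ≡ᵇ b')
G2 a b c d == G2 a' b' c' d' = (a ≡ᵇ a') ∧ (b ≡ᵇ b') ∧ (c ≡ᵇ c') ∧ (d ≡ᵇ d')
P a b c d == P a' b' c' d' = (a ≡ᵇ a') ∧ (b ≡ᵇ b') ∧ (c ≡ᵇ c') ∧ (d ≡ᵇ d')
_ == _ = false

LC : Set
LC = List (ℚ × Gen)

coeff : Gen → LC → ℚ
coeff g [] = 0ℚ
coeff g ((c , h) ∷ xs) = (if g == h then c else 0ℚ) + coeff g xs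

scale : ℚ → LC → LC
scale c = map (λ { (a , g) → (c * a , g) })

_⊖_ : LC → LC → LC
x ⊖ y = x ++ scale (- 1ℚ) y

shuffleSum : ℕ → ℕ → ℕ → ℕ → LC
shuffleSum k₁ k₂ d₁ d₂ =
  concatMap (λ i → map (λ e₁ →
      let l₁ = suc i ; l₂ = (k₁ ℕ.+ k₂) ∸ l₁ in
      ( ℕ→ℚ (((l₁ ∸ 1) C (k₁ ∸ 1)) ℕ.* (d₁ C e₁)) * sgn (d₁ ∸ e₁)
        + ℕ→ℚ (((l₁ ∸ 1) C (k₂ ∸ 1)) ℕ.* (d₂ C e₁)) * sgn (d₂ ∸ e₁)
      , G2 l₁ l₂ e₁ ((d₁ ℕ.+ d₂) ∸ e₁)))
    (upTo (suc (d₁ ℕ.+ d₂))))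
  (upTo ((k₁ ℕ.+ k₂) ∸ 1))

factorCoeff : ℕ → ℕ → ℚ
factorCoeff d₁ d₂ = (+ (d₁ ! ℕ.* d₂ !)) / (suc (d₁ ℕ.+ d₂) !)
  where instance _ = suc (d₁ ℕ.+ d₂) !≢0

stuffle : ℕ → ℕ → ℕ → ℕ → LC
stuffle k₁ k₂ d₁ d₂ =
  (1ℚ , G2 k₁ k₂ d₁ d₂) ∷ (1ℚ , G2 k₂ k₁ d₂ d₁) ∷ (1ℚ , G1 (k₁ ℕ.+ k₂) (d₁ ℕ.+ d₂)) ∷ []

shuffle : ℕ → ℕ → ℕ → ℕ → LC
shuffle k₁ k₂ d₁ d₂ =
  shuffleSum k₁ k₂ d₁ d₂ ++
  (factorCoeff d₁ d₂ * ℕ→ℚ ((k₁ ℕ.+ k₂ ∸ 2) C (k₁ ∸ 1))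
    , G1 (k₁ ℕ.+ k₂ ∸ 1) (suc (d₁ ℕ.+ d₂))) ∷ []

data Rel (K : ℕ) : Set where
  relP relSh : (k₁ k₂ d₁ d₂ : ℕ) → 1 ≤ k₁ → 1 ≤ k₂ → k₁ ℕ.+ k₂ ℕ.+ d₁ ℕ.+ d₂ ≡ K → Rel K

relLC : ∀ {K} → Rel K → LC
relLC (relP k₁ k₂ d₁ d₂ _ _ _) = ((1ℚ , P k₁ k₂ d₁ d₂) ∷ []) ⊖ stuffle k₁ k₂ d₁ d₂
relLC (relSh k₁ k₂ d₁ d₂ _ _ _) = stuffle k₁ k₂ d₁ d₂ ⊖ shuffle k₁ k₂ d₁ d₂

combine : ∀ {K} → List (ℚ × Rel K) → LC
combine = concatMap (λ { (c , r) → scale c (relLC r) })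

-- equality in the quotient E_K: x - y lies in the ℚ-span of the relations
_≈[_]_ : LC → ℕ → LC → Set
x ≈[ K ] y = Σ (List (ℚ × Rel K)) λ cs → ∀ g → coeff g (x ⊖ y) ≡ coeff g (combine cs)

thmLHS : ℕ → ℕ → LC
thmLHS k₁ k₂ =
  (((+ 1) / 2) * (ℕ→ℚ ((k₁ ℕ.+ k₂) C k₂) - sgn k₁) , G1 (k₁ ℕ.+ k₂) 0) ∷ []

thmRHS : ℕ → ℕ → LC
thmRHS k₁ k₂ =
  map (λ j → ( ℕ→ℚ ((k ∸ j ∸ 1) C (k₁ ∸ 1)) + ℕ→ℚ ((k ∸ j ∸ 1) C (k₂ ∸ 1)) - δ j k₁
             , P j (k ∸ j) 0 0))
      (filterᵇ (λ j → j % 2 ≡ᵇ 0) (map (2 ℕ.+_) (upTo (k ∸ 3))))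
  ++ (((+ 1) / 2) * (ℕ→ℚ ((k ∸ 3) C (k₁ ∸ 1)) + ℕ→ℚ ((k ∸ 3) C (k₂ ∸ 1)) + δ k₁ 1 + δ k₂ 1)
      , G1 (k ∸ 1) 1) ∷ []
  where k = k₁ ℕ.+ k₂

-- Write k₁ = m + 1, k₂ = n + 1 and N = m + n, so k = N + 2 with N even, and put H_l = G[l+1, k-l-1; 0, 0].
-- With d₁ = d₂ = 0 the double shuffle relation for k₁ = i + 1 reads
--   H_i + H_{N-i} + G[k;0] = Σ_l (C(l,i) + C(l,N-i)) H_l + C(N,i) G[k-1;1],
-- and the defining relation of P reads P[i+1, N-i+1; 0, 0] = H_i + H_{N-i} + G[k;0].
-- The theorem is the combination of the shuffle relations with weights
-- β_i = ½((-1)^i F_i + δ_{i,m}), F_i = C(N-i,m) + C(N-i,n), and of the P relations with weights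
-- -γ_l = -½(1 - (-1)^l)(F_l - δ_{l,m}).  Every H_l cancels because
--   Σ_i β_i (C(l,i) + C(l,N-i)) = β_l + β_{N-l} + γ_l + γ_{N-l},
-- which follows from the alternating binomial sums Σ_i (-1)^i C(l,i) C(q-i,m) = C(q-l,n) (m + n = q) and
-- Σ_i (-1)^i C(l,i) C(i,m) = (-1)^m δ_{l,m}; the coefficients of G[k;0] and G[k-1;1] then follow from the
-- hockey-stick identity.  Identities between formal combinations are proved by evaluating both sides at an
-- arbitrary valuation of the generators, coefficients being the values at indicator valuations.

module Submission where

open import Algebra.Bundles using (CommutativeMonoid)
open import Data.Bool using (Bool; true; false; if_then_else_)
open import Data.Empty using (⊥-elim)
import Data.Integer as ℤ
import Data.Integer.Properties as ℤₚ
open import Data.List using (List; []; _∷_; _++_; map; concatMap; upTo; applyUpTo; filterᵇ)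
open import Data.Nat as ℕ using (ℕ; zero; suc; _∸_; _≡ᵇ_; _%_; z≤n; s≤s)
import Data.Nat.Properties as ℕₚ
open import Data.Nat.Combinatorics using (_C_; nCk+nC[k+1]≡[n+1]C[k+1]; nCk≡nC[n∸k]; k>n⇒nCk≡0)
import Data.Nat.Coprimality as Coprime
open import Data.Nat.Divisibility using (_∣_; divides)
open import Data.Product using (_×_; _,_; proj₁; proj₂)
open import Data.Rational
open import Data.Rational.Properties
open import Data.Rational.Solver using (module +-*-Solver)
open import Function using (_∘_)
open import Relation.Binary.PropositionalEquality
open import Relation.Nullary using (yes; no)

open import Algebra.Properties.Group +-0-group using () renaming (⁻¹-involutive to neg-involutive)
open import Algebra.Properties.CommutativeSemigroup (CommutativeMonoid.commutativeSemigroup +-0-commutativeMonoid)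
  using (interchange)
open import Defs

open +-*-Solver using (solve; _:=_; _:+_; _:-_; _:*_; :-_; con)
open ≡-Reasoning

∑< : ℕ → (ℕ → ℚ) → ℚ
∑< zero    f = 0ℚ
∑< (suc n) f = ∑< n f + f n

infix 6.5 ∑<
syntax ∑< n (λ i → e) = ∑[ i < n ] e

∑-cong : ∀ n {f g : ℕ → ℚ} → (∀ i → i ℕ.< n → f i ≡ g i) → ∑< n f ≡ ∑< n g
∑-cong zero    f≗g = refl
∑-cong (suc n) f≗g = cong₂ _+_ (∑-cong n λ i i<n → f≗g i (ℕₚ.m<n⇒m<1+n i<n)) (f≗g n (ℕₚ.n<1+n n))

∑-zero : ∀ n {f : ℕ → ℚ} → (∀ i → i ℕ.< n → f i ≡ 0ℚ) → ∑< n f ≡ 0ℚ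
∑-zero n f≗0 = trans (∑-cong n f≗0) (∑-0 n)
  where
  ∑-0 : ∀ n → ∑[ i < n ] 0ℚ ≡ 0ℚ
  ∑-0 zero    = refl
  ∑-0 (suc n) = cong (_+ 0ℚ) (∑-0 n)

∑-+ : ∀ n (f g : ℕ → ℚ) → ∑[ i < n ] (f i + g i) ≡ ∑< n f + ∑< n g
∑-+ zero    f g = refl
∑-+ (suc n) f g = begin
  ∑[ i < n ] (f i + g i) + (f n + g n) ≡⟨ cong (_+ (f n + g n)) (∑-+ n f g) ⟩
  ∑< n f + ∑< n g + (f n + g n)        ≡⟨ interchange (∑< n f) (∑< n g) (f n) (g n) ⟩
  ∑< (suc n) f + ∑< (suc n) g          ∎

∑-neg : ∀ n (f : ℕ → ℚ) → ∑[ i < n ] (- f i) ≡ - ∑< n f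
∑-neg zero    f = refl
∑-neg (suc n) f = trans (cong (_+ - f n) (∑-neg n f)) (sym (neg-distrib-+ (∑< n f) (f n)))

∑-- : ∀ n (f g : ℕ → ℚ) → ∑[ i < n ] (f i - g i) ≡ ∑< n f - ∑< n g
∑-- n f g = trans (∑-+ n f (λ i → - g i)) (cong (∑< n f +_) (∑-neg n g))

∑-*ˡ : ∀ n c (f : ℕ → ℚ) → ∑[ i < n ] (c * f i) ≡ c * ∑< n f
∑-*ˡ zero    c f = sym (*-zeroʳ c)
∑-*ˡ (suc n) c f = trans (cong (_+ c * f n) (∑-*ˡ n c f)) (sym (*-distribˡ-+ c (∑< n f) (f n)))

∑-*ʳ : ∀ n c (f : ℕ → ℚ) → ∑[ i < n ] (f i * c) ≡ ∑< n f * c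
∑-*ʳ n c f = trans (∑-cong n λ i _ → *-comm (f i) c) (trans (∑-*ˡ n c f) (*-comm c (∑< n f)))

∑-swap : ∀ a b (f : ℕ → ℕ → ℚ) → ∑[ i < a ] ∑[ l < b ] f i l ≡ ∑[ l < b ] ∑[ i < a ] f i l
∑-swap zero    b f = sym (∑-zero b λ _ _ → refl)
∑-swap (suc a) b f = trans (cong (_+ ∑[ l < b ] f a l) (∑-swap a b f)) (sym (∑-+ b _ _))

∑-suc : ∀ n (f : ℕ → ℚ) → ∑< (suc n) f ≡ f 0 + ∑[ i < n ] f (suc i)
∑-suc zero    f = trans (+-identityˡ (f 0)) (sym (+-identityʳ (f 0)))
∑-suc (suc n) f = trans (cong (_+ f (suc n)) (∑-suc n f)) (+-assoc (f 0) _ _)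

∑-reflect : ∀ N (f : ℕ → ℚ) → ∑[ i < suc N ] f (N ∸ i) ≡ ∑< (suc N) f
∑-reflect N f = reflect (suc N)
  where
  reflect : ∀ n → ∑[ i < n ] f (n ∸ suc i) ≡ ∑< n f
  reflect zero    = refl
  reflect (suc n) = begin
    ∑[ i < suc n ] f (n ∸ i)      ≡⟨ ∑-suc n (λ i → f (n ∸ i)) ⟩
    f n + ∑[ i < n ] f (n ∸ suc i) ≡⟨ cong (f n +_) (reflect n) ⟩
    f n + ∑< n f                   ≡⟨ +-comm (f n) (∑< n f) ⟩
    ∑< (suc n) f                   ∎

∑-extend : ∀ {n M} (f : ℕ → ℚ) → n ℕ.≤ M → (∀ i → n ℕ.≤ i → f i ≡ 0ℚ) → ∑< M f ≡ ∑< n f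
∑-extend {n} f n≤M f≗0 with ℕₚ.m≤n⇒∃[o]m+o≡n n≤M
... | k , refl = go k
  where
  go : ∀ k → ∑< (n ℕ.+ k) f ≡ ∑< n f
  go zero    = cong (λ j → ∑< j f) (ℕₚ.+-identityʳ n)
  go (suc k) = begin
    ∑< (n ℕ.+ suc k) f          ≡⟨ cong (λ j → ∑< j f) (ℕₚ.+-suc n k) ⟩
    ∑< (n ℕ.+ k) f + f (n ℕ.+ k) ≡⟨ cong₂ _+_ (go k) (f≗0 (n ℕ.+ k) (ℕₚ.m≤m+n n k)) ⟩
    ∑< n f + 0ℚ                  ≡⟨ +-identityʳ (∑< n f) ⟩
    ∑< n f                       ∎

δ-self : ∀ a → δ a a ≡ 1ℚ
δ-self zero    = refl
δ-self (suc a) = δ-self a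

δ-≢ : ∀ {a b} → a ≢ b → δ a b ≡ 0ℚ
δ-≢ {zero}  {zero}  a≢b = ⊥-elim (a≢b refl)
δ-≢ {zero}  {suc b} a≢b = refl
δ-≢ {suc a} {zero}  a≢b = refl
δ-≢ {suc a} {suc b} a≢b = δ-≢ (a≢b ∘ cong suc)

δ-transport : ∀ (f : ℕ → ℚ) l a → f a * δ l a ≡ f l * δ l a
δ-transport f l a with l ℕₚ.≟ a
... | yes refl = refl
... | no  l≢a  = trans (vanish a) (sym (vanish l))
  where
  vanish : ∀ x → f x * δ l a ≡ 0ℚ
  vanish x = trans (cong (f x *_) (δ-≢ l≢a)) (*-zeroʳ (f x))

∑-δ : ∀ {m n} (f : ℕ → ℚ) → m ℕ.< n → ∑[ i < n ] δ i m * f i ≡ f m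
∑-δ {m} {n} f m<n = begin
  ∑[ i < n ] δ i m * f i                    ≡⟨ ∑-extend (λ i → δ i m * f i) m<n above-m ⟩
  ∑[ i < m ] δ i m * f i + δ m m * f m      ≡⟨ cong₂ _+_ (∑-zero m below-m) (cong (_* f m) (δ-self m)) ⟩
  0ℚ + 1ℚ * f m                            ≡⟨ trans (+-identityˡ _) (*-identityˡ (f m)) ⟩
  f m                                       ∎
  where
  vanish : ∀ {i} → i ≢ m → δ i m * f i ≡ 0ℚ
  vanish {i} i≢m = trans (cong (_* f i) (δ-≢ i≢m)) (*-zeroˡ (f i))
  above-m : ∀ i → suc m ℕ.≤ i → δ i m * f i ≡ 0ℚ
  above-m i m<i = vanish (ℕₚ.>⇒≢ m<i)
  below-m : ∀ i → i ℕ.< m → δ i m * f i ≡ 0ℚ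
  below-m i i<m = vanish (ℕₚ.<⇒≢ i<m)

∑-drop-ends : ∀ n (f : ℕ → ℚ) → f 0 ≡ 0ℚ → f (suc n) ≡ 0ℚ → ∑< (suc (suc n)) f ≡ ∑[ t < n ] f (suc t)
∑-drop-ends n f f0≡0 fn≡0 = begin
  ∑< (suc n) f + f (suc n)                 ≡⟨ cong₂ _+_ (∑-suc n f) fn≡0 ⟩
  f 0 + ∑[ t < n ] f (suc t) + 0ℚ          ≡⟨ +-identityʳ _ ⟩
  f 0 + ∑[ t < n ] f (suc t)               ≡⟨ cong (_+ ∑[ t < n ] f (suc t)) f0≡0 ⟩
  0ℚ + ∑[ t < n ] f (suc t)                ≡⟨ +-identityˡ _ ⟩
  ∑[ t < n ] f (suc t)                     ∎

∑-pair-reflect : ∀ N (a h : ℕ → ℚ) →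
  ∑[ i < suc N ] a i * (h i + h (N ∸ i)) ≡ ∑[ i < suc N ] (a i + a (N ∸ i)) * h i
∑-pair-reflect N a h = begin
  ∑[ i < suc N ] a i * (h i + h (N ∸ i))                      ≡⟨ ∑-cong (suc N) (λ i _ → *-distribˡ-+ (a i) (h i) _) ⟩
  ∑[ i < suc N ] (a i * h i + a i * h (N ∸ i))                ≡⟨ ∑-+ (suc N) _ _ ⟩
  ∑[ i < suc N ] a i * h i + ∑[ i < suc N ] a i * h (N ∸ i)   ≡⟨ cong (∑[ i < suc N ] a i * h i +_) reflected ⟩
  ∑[ i < suc N ] a i * h i + ∑[ i < suc N ] a (N ∸ i) * h i   ≡⟨ ∑-+ (suc N) _ _ ⟨
  ∑[ i < suc N ] (a i * h i + a (N ∸ i) * h i)                ≡⟨ ∑-cong (suc N) (λ i _ → *-distribʳ-+ (h i) (a i) _) ⟨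
  ∑[ i < suc N ] (a i + a (N ∸ i)) * h i                      ∎
  where
  reflected : ∑[ i < suc N ] a i * h (N ∸ i) ≡ ∑[ i < suc N ] a (N ∸ i) * h i
  reflected = trans (sym (∑-reflect N (λ i → a i * h (N ∸ i))))
                    (∑-cong (suc N) λ i i≤N → cong (λ j → a (N ∸ i) * h j) (ℕₚ.m∸[m∸n]≡n (ℕₚ.≤-pred i≤N)))

∑-*-∑ : ∀ n k (a : ℕ → ℚ) (c : ℕ → ℕ → ℚ) (h : ℕ → ℚ) →
  ∑[ i < n ] a i * (∑[ l < k ] c l i * h l) ≡ ∑[ l < k ] (∑[ i < n ] a i * c l i) * h l
∑-*-∑ n k a c h = begin
  ∑[ i < n ] a i * (∑[ l < k ] c l i * h l)    ≡⟨ ∑-cong n (λ i _ → ∑-*ˡ k (a i) _) ⟨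
  ∑[ i < n ] ∑[ l < k ] a i * (c l i * h l)    ≡⟨ ∑-swap n k _ ⟩
  ∑[ l < k ] ∑[ i < n ] a i * (c l i * h l)    ≡⟨ ∑-cong k (λ l _ → ∑-cong n λ i _ → *-assoc (a i) _ _) ⟨
  ∑[ l < k ] ∑[ i < n ] a i * c l i * h l      ≡⟨ ∑-cong k (λ l _ → ∑-*ʳ n (h l) _) ⟩
  ∑[ l < k ] (∑[ i < n ] a i * c l i) * h l    ∎

sign : ℕ → ℚ
sign zero    = 1ℚ
sign (suc i) = - sign i

sign-+ : ∀ a b → sign (a ℕ.+ b) ≡ sign a * sign b
sign-+ zero    b = sym (*-identityˡ (sign b))
sign-+ (suc a) b = trans (cong -_ (sign-+ a b)) (neg-distribˡ-* (sign a) (sign b))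

sign-square : ∀ a → sign a * sign a ≡ 1ℚ
sign-square zero    = refl
sign-square (suc a) = trans (solve 1 (λ x → (:- x) :* (:- x) := x :* x) refl (sign a)) (sign-square a)

sign-∸ : ∀ {N i} → sign N ≡ 1ℚ → i ℕ.≤ N → sign (N ∸ i) ≡ sign i
sign-∸ {N} {i} sign-N i≤N = begin
  sign (N ∸ i)                     ≡⟨ *-identityʳ _ ⟨
  sign (N ∸ i) * 1ℚ                ≡⟨ cong (sign (N ∸ i) *_) (sign-square i) ⟨
  sign (N ∸ i) * (sign i * sign i) ≡⟨ *-assoc (sign (N ∸ i)) _ _ ⟨
  sign (N ∸ i) * sign i * sign i   ≡⟨ cong (_* sign i) (sign-+ (N ∸ i) i) ⟨
  sign (N ∸ i ℕ.+ i) * sign i      ≡⟨ cong (λ j → sign j * sign i) (ℕₚ.m∸n+n≡m i≤N) ⟩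
  sign N * sign i                  ≡⟨ cong (_* sign i) sign-N ⟩
  1ℚ * sign i                      ≡⟨ *-identityˡ (sign i) ⟩
  sign i                           ∎

sign-double : ∀ q → sign (q ℕ.* 2) ≡ 1ℚ
sign-double zero    = refl
sign-double (suc q) = trans (neg-involutive (sign (q ℕ.* 2))) (sign-double q)

sgn≡sign : ∀ n → sgn n ≡ sign n
sgn≡sign zero          = refl
sgn≡sign (suc zero)    = refl
sgn≡sign (suc (suc n)) = trans (sgn≡sign n) (sym (neg-involutive (sign n)))

if-even : ∀ t x → (if t % 2 ≡ᵇ 0 then x else 0ℚ) ≡ ½ * (1ℚ + sign t) * x
if-even zero          x = sym (*-identityˡ x)
if-even (suc zero)    x = sym (*-zeroˡ x)
if-even (suc (suc t)) x = trans (if-even t x) (cong (λ s → ½ * (1ℚ + s) * x) (sym (neg-involutive (sign t))))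

ℕ→ℚ≡mkℚ : ∀ a → ℕ→ℚ a ≡ mkℚ (ℤ.+ a) 0 (Coprime.sym (Coprime.1-coprimeTo a))
ℕ→ℚ≡mkℚ a = normalize-coprime (Coprime.sym (Coprime.1-coprimeTo a))

ℕ→ℚ-+ : ∀ a b → ℕ→ℚ (a ℕ.+ b) ≡ ℕ→ℚ a + ℕ→ℚ b
ℕ→ℚ-+ a b rewrite ℕ→ℚ≡mkℚ a | ℕ→ℚ≡mkℚ b =
  sym (cong (_/ 1) (trans (cong₂ ℤ._+_ (ℤₚ.*-identityʳ (ℤ.+ a)) (ℤₚ.*-identityʳ (ℤ.+ b))) (sym (ℤₚ.pos-+ a b))))

binom : ℕ → ℕ → ℚ
binom n k = ℕ→ℚ (n C k)

binom-pascal : ∀ n k → binom (suc n) (suc k) ≡ binom n k + binom n (suc k)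
binom-pascal n k = trans (cong ℕ→ℚ (sym (nCk+nC[k+1]≡[n+1]C[k+1] n k))) (ℕ→ℚ-+ (n C k) (n C suc k))

binom-vanish : ∀ {n k} → n ℕ.< k → binom n k ≡ 0ℚ
binom-vanish n<k = cong ℕ→ℚ (k>n⇒nCk≡0 n<k)

binom-sym : ∀ m n → binom (m ℕ.+ n) m ≡ binom (m ℕ.+ n) n
binom-sym m n = cong ℕ→ℚ (trans (nCk≡nC[n∸k] (ℕₚ.m≤m+n m n)) (cong ((m ℕ.+ n) C_) (ℕₚ.m+n∸m≡n m n)))

hockey-stick : ∀ N m → ∑[ i < suc N ] binom i m ≡ binom (suc N) (suc m)
hockey-stick zero    m = trans (+-identityˡ (binom 0 m)) (sym (trans (binom-pascal 0 m) (+-identityʳ (binom 0 m))))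
hockey-stick (suc N) m = begin
  ∑[ i < suc N ] binom i m + binom (suc N) m    ≡⟨ cong (_+ binom (suc N) m) (hockey-stick N m) ⟩
  binom (suc N) (suc m) + binom (suc N) m       ≡⟨ +-comm (binom (suc N) (suc m)) _ ⟩
  binom (suc N) m + binom (suc N) (suc m)       ≡⟨ binom-pascal (suc N) m ⟨
  binom (suc (suc N)) (suc m)                   ∎

binom0≡δ : ∀ m → binom 0 m ≡ δ m 0
binom0≡δ zero    = refl
binom0≡δ (suc m) = refl

binom-pred-pair : ∀ m n → 1 ℕ.≤ m ℕ.+ n → binom (m ℕ.+ n ∸ 1) m + binom (m ℕ.+ n ∸ 1) n ≡ binom (m ℕ.+ n) m
binom-pred-pair zero    (suc n) _ = trans (cong (1ℚ +_) (binom-vanish (ℕₚ.n<1+n n))) (+-identityʳ 1ℚ)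
binom-pred-pair (suc m) n       _ = begin
  binom (m ℕ.+ n) (suc m) + binom (m ℕ.+ n) n ≡⟨ cong (binom (m ℕ.+ n) (suc m) +_) (binom-sym m n) ⟨
  binom (m ℕ.+ n) (suc m) + binom (m ℕ.+ n) m ≡⟨ +-comm (binom (m ℕ.+ n) (suc m)) _ ⟩
  binom (m ℕ.+ n) m + binom (m ℕ.+ n) (suc m) ≡⟨ binom-pascal (m ℕ.+ n) m ⟨
  binom (suc m ℕ.+ n) (suc m)                 ∎

-- Finite differences

diff : ℕ → (ℕ → ℚ) → ℚ
diff zero    φ = φ 0
diff (suc l) φ = diff l φ - diff l (λ i → φ (suc i))

diff-cong : ∀ l {φ ψ : ℕ → ℚ} → (∀ i → φ i ≡ ψ i) → diff l φ ≡ diff l ψ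
diff-cong zero    φ≗ψ = φ≗ψ 0
diff-cong (suc l) φ≗ψ = cong₂ _-_ (diff-cong l φ≗ψ) (diff-cong l (φ≗ψ ∘ suc))

diff-0 : ∀ l → diff l (λ _ → 0ℚ) ≡ 0ℚ
diff-0 zero    = refl
diff-0 (suc l) = cong₂ _-_ (diff-0 l) (diff-0 l)

diff-+ : ∀ l (φ ψ : ℕ → ℚ) → diff l (λ i → φ i + ψ i) ≡ diff l φ + diff l ψ
diff-+ zero    φ ψ = refl
diff-+ (suc l) φ ψ =
  trans (cong₂ _-_ (diff-+ l φ ψ) (diff-+ l (φ ∘ suc) (ψ ∘ suc)))
        (solve 4 (λ a b c d → (a :+ b) :- (c :+ d) := (a :- c) :+ (b :- d)) refl
               (diff l φ) (diff l ψ) (diff l (φ ∘ suc)) (diff l (ψ ∘ suc)))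

diff-expansion : ∀ l {M} (φ : ℕ → ℚ) → l ℕ.≤ M → ∑[ i < suc M ] sign i * binom l i * φ i ≡ diff l φ
diff-expansion l φ l≤M = trans (∑-extend _ (s≤s l≤M) (beyond l φ)) (expansion l φ)
  where
  beyond : ∀ l (φ : ℕ → ℚ) i → l ℕ.< i → sign i * binom l i * φ i ≡ 0ℚ
  beyond l φ i l<i = trans (cong (λ b → sign i * b * φ i) (binom-vanish l<i))
                         (solve 2 (λ s x → s :* con 0ℚ :* x := con 0ℚ) refl (sign i) (φ i))

  expansion : ∀ l (φ : ℕ → ℚ) → ∑[ i < suc l ] sign i * binom l i * φ i ≡ diff l φ
  expansion zero    φ = trans (+-identityˡ _) (*-identityˡ (φ 0))
  expansion (suc l) φ = begin
    ∑[ i < suc (suc l) ] sign i * binom (suc l) i * φ i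
      ≡⟨ ∑-suc (suc l) _ ⟩
    1ℚ * φ 0 + ∑[ i < suc l ] sign (suc i) * binom (suc l) (suc i) * φ (suc i)
      ≡⟨ cong (1ℚ * φ 0 +_) (∑-cong (suc l) λ i _ → pascal-term i) ⟩
    1ℚ * φ 0 + ∑[ i < suc l ] (sign (suc i) * binom l (suc i) * φ (suc i) - sign i * binom l i * φ (suc i))
      ≡⟨ cong (1ℚ * φ 0 +_) (∑-- (suc l) _ _) ⟩
    1ℚ * φ 0 + (∑[ i < suc l ] sign (suc i) * binom l (suc i) * φ (suc i)
                - ∑[ i < suc l ] sign i * binom l i * φ (suc i))
      ≡⟨ +-assoc (1ℚ * φ 0) _ _ ⟨
    1ℚ * φ 0 + ∑[ i < suc l ] sign (suc i) * binom l (suc i) * φ (suc i) - ∑[ i < suc l ] sign i * binom l i * φ (suc i)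
      ≡⟨ cong (_- ∑[ i < suc l ] sign i * binom l i * φ (suc i)) (∑-suc (suc l) _) ⟨
    ∑[ i < suc (suc l) ] sign i * binom l i * φ i - ∑[ i < suc l ] sign i * binom l i * φ (suc i)
      ≡⟨ cong₂ _-_ (trans (∑-extend _ (ℕₚ.n≤1+n (suc l)) (beyond l φ)) (expansion l φ)) (expansion l (φ ∘ suc)) ⟩
    diff l φ - diff l (φ ∘ suc)
      ∎
    where
    pascal-term : ∀ i → sign (suc i) * binom (suc l) (suc i) * φ (suc i)
                      ≡ sign (suc i) * binom l (suc i) * φ (suc i) - sign i * binom l i * φ (suc i)
    pascal-term i = trans (cong (λ b → sign (suc i) * b * φ (suc i)) (binom-pascal l i))
      (solve 4 (λ s a b x → (:- s) :* (a :+ b) :* x := (:- s) :* b :* x :- s :* a :* x) refl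
             (sign i) (binom l i) (binom l (suc i)) (φ (suc i)))

diff-binom-reflect : ∀ l q m n → m ℕ.+ n ≡ q → l ℕ.≤ q → diff l (λ i → binom (q ∸ i) m) ≡ binom (q ∸ l) n
diff-binom-reflect zero    q       m n       refl _         = binom-sym m n
diff-binom-reflect (suc l) (suc q) m (suc n) m+n≡q (s≤s l≤q) = begin
  diff l (λ i → binom (suc q ∸ i) m) - diff l (λ i → binom (q ∸ i) m)
    ≡⟨ cong₂ _-_ (diff-binom-reflect l (suc q) m (suc n) m+n≡q (ℕₚ.m≤n⇒m≤1+n l≤q))
                 (diff-binom-reflect l q m n (ℕₚ.suc-injective (trans (sym (ℕₚ.+-suc m n)) m+n≡q)) l≤q) ⟩
  binom (suc q ∸ l) (suc n) - binom (q ∸ l) n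
    ≡⟨ cong (λ j → binom j (suc n) - binom (q ∸ l) n) (ℕₚ.+-∸-assoc 1 l≤q) ⟩
  binom (suc (q ∸ l)) (suc n) - binom (q ∸ l) n
    ≡⟨ cong (_- binom (q ∸ l) n) (binom-pascal (q ∸ l) n) ⟩
  binom (q ∸ l) n + binom (q ∸ l) (suc n) - binom (q ∸ l) n
    ≡⟨ solve 2 (λ x y → x :+ y :- x := y) refl (binom (q ∸ l) n) _ ⟩
  binom (q ∸ l) (suc n)
    ∎
diff-binom-reflect (suc l) (suc q) m zero m+0≡q (s≤s l≤q) =
  cong₂ _-_ (diff-binom-reflect l (suc q) m zero m+0≡q (ℕₚ.m≤n⇒m≤1+n l≤q))
            (trans (diff-cong l (λ i → binom-vanish (ℕₚ.≤-<-trans (ℕₚ.m∸n≤m q i) q<m))) (diff-0 l))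
  where
  q<m : q ℕ.< m
  q<m = subst (q ℕ.<_) (trans (sym m+0≡q) (ℕₚ.+-identityʳ m)) (ℕₚ.n<1+n q)

diff-binom : ∀ l m → diff l (λ i → binom i m) ≡ sign m * δ l m
diff-binom zero    zero    = refl
diff-binom zero    (suc m) = sym (*-zeroʳ (sign (suc m)))
diff-binom (suc l) zero    = +-inverseʳ (diff l (λ _ → 1ℚ))
diff-binom (suc l) (suc m) = begin
  diff l (λ i → binom i (suc m)) - diff l (λ i → binom (suc i) (suc m))
    ≡⟨ cong (_-_ (diff l (λ i → binom i (suc m)))) (trans (diff-cong l (λ i → binom-pascal i m)) (diff-+ l _ _)) ⟩
  diff l (λ i → binom i (suc m)) - (diff l (λ i → binom i m) + diff l (λ i → binom i (suc m)))
    ≡⟨ solve 2 (λ x y → x :- (y :+ x) := :- y) refl (diff l (λ i → binom i (suc m))) _ ⟩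
  - diff l (λ i → binom i m)
    ≡⟨ cong -_ (diff-binom l m) ⟩
  - (sign m * δ l m)
    ≡⟨ neg-distribˡ-* (sign m) (δ l m) ⟩
  sign (suc m) * δ (suc l) (suc m)
    ∎

-- Evaluating formal combinations

sumL : ∀ {A : Set} → (A → ℚ) → List A → ℚ
sumL f []       = 0ℚ
sumL f (x ∷ xs) = f x + sumL f xs

sumL-++ : ∀ {A : Set} (f : A → ℚ) xs ys → sumL f (xs ++ ys) ≡ sumL f xs + sumL f ys
sumL-++ f []       ys = sym (+-identityˡ (sumL f ys))
sumL-++ f (x ∷ xs) ys = trans (cong (f x +_) (sumL-++ f xs ys)) (sym (+-assoc (f x) _ _))

sumL-map : ∀ {A B : Set} (f : B → ℚ) (h : A → B) xs → sumL f (map h xs) ≡ sumL (f ∘ h) xs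
sumL-map f h []       = refl
sumL-map f h (x ∷ xs) = cong (f (h x) +_) (sumL-map f h xs)

sumL-filterᵇ : ∀ {A : Set} (f : A → ℚ) (p : A → Bool) xs →
  sumL f (filterᵇ p xs) ≡ sumL (λ x → if p x then f x else 0ℚ) xs
sumL-filterᵇ f p []       = refl
sumL-filterᵇ f p (x ∷ xs) with p x
... | true  = cong (f x +_) (sumL-filterᵇ f p xs)
... | false = trans (sumL-filterᵇ f p xs) (sym (+-identityˡ _))

sumL-applyUpTo : ∀ (f : ℕ → ℚ) (g : ℕ → ℕ) n → sumL f (applyUpTo g n) ≡ ∑[ i < n ] f (g i)
sumL-applyUpTo f g zero    = refl
sumL-applyUpTo f g (suc n) = trans (cong (f (g 0) +_) (sumL-applyUpTo f (g ∘ suc) n)) (sym (∑-suc n (f ∘ g)))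

sumL-upTo : ∀ (f : ℕ → ℚ) n → sumL f (upTo n) ≡ ∑< n f
sumL-upTo f = sumL-applyUpTo f (λ i → i)

eval : (Gen → ℚ) → LC → ℚ
eval v []             = 0ℚ
eval v ((c , g) ∷ xs) = c * v g + eval v xs

indicator : Gen → Gen → ℚ
indicator g h = if g == h then 1ℚ else 0ℚ

coeff≡eval : ∀ g xs → coeff g xs ≡ eval (indicator g) xs
coeff≡eval g []             = refl
coeff≡eval g ((c , h) ∷ xs) = cong₂ _+_ (select (g == h)) (coeff≡eval g xs)
  where
  select : ∀ b → (if b then c else 0ℚ) ≡ c * (if b then 1ℚ else 0ℚ)
  select true  = sym (*-identityʳ c)
  select false = sym (*-zeroʳ c)

module _ (v : Gen → ℚ) where

  eval-++ : ∀ xs ys → eval v (xs ++ ys) ≡ eval v xs + eval v ys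
  eval-++ []             ys = sym (+-identityˡ (eval v ys))
  eval-++ ((c , g) ∷ xs) ys = trans (cong (c * v g +_) (eval-++ xs ys)) (sym (+-assoc (c * v g) _ _))

  eval-scale : ∀ a xs → eval v (scale a xs) ≡ a * eval v xs
  eval-scale a []             = sym (*-zeroʳ a)
  eval-scale a ((c , g) ∷ xs) = begin
    a * c * v g + eval v (scale a xs)   ≡⟨ cong₂ _+_ (*-assoc a c (v g)) (eval-scale a xs) ⟩
    a * (c * v g) + a * eval v xs       ≡⟨ *-distribˡ-+ a _ _ ⟨
    a * (c * v g + eval v xs)           ∎

  eval-⊖ : ∀ xs ys → eval v (xs ⊖ ys) ≡ eval v xs - eval v ys
  eval-⊖ xs ys = trans (eval-++ xs (scale (- 1ℚ) ys))
    (cong (eval v xs +_) (trans (eval-scale (- 1ℚ) ys) (solve 1 (λ y → con (- 1ℚ) :* y := :- y) refl (eval v ys))))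

  eval-map : ∀ {A : Set} (f : A → ℚ × Gen) xs → eval v (map f xs) ≡ sumL (λ x → proj₁ (f x) * v (proj₂ (f x))) xs
  eval-map f []       = refl
  eval-map f (x ∷ xs) = cong (proj₁ (f x) * v (proj₂ (f x)) +_) (eval-map f xs)

  eval-concatMap : ∀ {A : Set} (f : A → LC) xs → eval v (concatMap f xs) ≡ sumL (eval v ∘ f) xs
  eval-concatMap f []       = refl
  eval-concatMap f (x ∷ xs) = trans (eval-++ (f x) _) (cong (eval v (f x) +_) (eval-concatMap f xs))

  evalTerm : ∀ {K} → ℚ × Rel K → ℚ
  evalTerm (c , r) = c * eval v (relLC r)

  eval-combine : ∀ {K} (cs : List (ℚ × Rel K)) → eval v (combine cs) ≡ sumL evalTerm cs
  eval-combine []             = refl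
  eval-combine ((c , r) ∷ cs) =
    trans (eval-++ (scale c (relLC r)) _) (cong₂ _+_ (eval-scale c (relLC r)) (eval-combine cs))

  eval-stuffle : ∀ k₁ k₂ d₁ d₂ →
    eval v (stuffle k₁ k₂ d₁ d₂) ≡ v (G2 k₁ k₂ d₁ d₂) + v (G2 k₂ k₁ d₂ d₁) + v (G1 (k₁ ℕ.+ k₂) (d₁ ℕ.+ d₂))
  eval-stuffle k₁ k₂ d₁ d₂ =
    solve 3 (λ x y z → con 1ℚ :* x :+ (con 1ℚ :* y :+ (con 1ℚ :* z :+ con 0ℚ)) := x :+ y :+ z) refl
            (v (G2 k₁ k₂ d₁ d₂)) (v (G2 k₂ k₁ d₂ d₁)) (v (G1 (k₁ ℕ.+ k₂) (d₁ ℕ.+ d₂)))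

  eval-shuffle : ∀ a b →
    eval v (shuffle (suc a) (suc b) 0 0)
      ≡ ∑[ l < suc a ℕ.+ suc b ∸ 1 ] (binom l a + binom l b) * v (G2 (suc l) (suc a ℕ.+ suc b ∸ suc l) 0 0)
        + binom (suc a ℕ.+ suc b ∸ 2) a * v (G1 (suc a ℕ.+ suc b ∸ 1) 1)
  eval-shuffle a b = begin
    eval v (shuffle (suc a) (suc b) 0 0)
      ≡⟨ eval-++ (shuffleSum (suc a) (suc b) 0 0) _ ⟩
    eval v (shuffleSum (suc a) (suc b) 0 0) + eval v ((1ℚ * binom (K ∸ 2) a , G1 (K ∸ 1) 1) ∷ [])
      ≡⟨ cong₂ _+_ (trans (eval-concatMap _ (upTo (K ∸ 1)))
                          (trans (sumL-upTo _ (K ∸ 1)) (∑-cong (K ∸ 1) (λ l _ → term l))))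
                   (trans (+-identityʳ _) (cong (_* v (G1 (K ∸ 1) 1)) (*-identityˡ (binom (K ∸ 2) a)))) ⟩
    ∑[ l < K ∸ 1 ] (binom l a + binom l b) * v (G2 (suc l) (K ∸ suc l) 0 0) + binom (K ∸ 2) a * v (G1 (K ∸ 1) 1)
      ∎
    where
    K = suc a ℕ.+ suc b
    -- at d₁ = d₂ = 0 the inner index e₁ of shuffleSum only takes the value 0
    term : ∀ l → (ℕ→ℚ ((l C a) ℕ.* 1) * 1ℚ + ℕ→ℚ ((l C b) ℕ.* 1) * 1ℚ) * v (G2 (suc l) (K ∸ suc l) 0 0) + 0ℚ
               ≡ (binom l a + binom l b) * v (G2 (suc l) (K ∸ suc l) 0 0)
    term l = trans (+-identityʳ _) (cong (_* v (G2 (suc l) (K ∸ suc l) 0 0))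
      (cong₂ _+_ (trans (*-identityʳ _) (cong ℕ→ℚ (ℕₚ.*-identityʳ (l C a))))
                 (trans (*-identityʳ _) (cong ℕ→ℚ (ℕₚ.*-identityʳ (l C b))))))

  eval-shuffleRelation : ∀ {a b K} → suc a ℕ.+ suc b ≡ K →
    eval v (stuffle (suc a) (suc b) 0 0 ⊖ shuffle (suc a) (suc b) 0 0)
      ≡ v (G2 (suc a) (suc b) 0 0) + v (G2 (suc b) (suc a) 0 0) + v (G1 K 0)
        - (∑[ l < K ∸ 1 ] (binom l a + binom l b) * v (G2 (suc l) (K ∸ suc l) 0 0) + binom (K ∸ 2) a * v (G1 (K ∸ 1) 1))
  eval-shuffleRelation {a} {b} refl =
    trans (eval-⊖ (stuffle (suc a) (suc b) 0 0) (shuffle (suc a) (suc b) 0 0))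
          (cong₂ _-_ (eval-stuffle (suc a) (suc b) 0 0) (eval-shuffle a b))

  eval-stuffleRelation : ∀ k₁ k₂ →
    eval v (((1ℚ , P k₁ k₂ 0 0) ∷ []) ⊖ stuffle k₁ k₂ 0 0)
      ≡ v (P k₁ k₂ 0 0) - (v (G2 k₁ k₂ 0 0) + v (G2 k₂ k₁ 0 0) + v (G1 (k₁ ℕ.+ k₂) 0))
  eval-stuffleRelation k₁ k₂ =
    trans (eval-⊖ ((1ℚ , P k₁ k₂ 0 0) ∷ []) (stuffle k₁ k₂ 0 0))
          (cong₂ _-_ (trans (+-identityʳ _) (*-identityˡ (v (P k₁ k₂ 0 0)))) (eval-stuffle k₁ k₂ 0 0))

≈-by-eval : ∀ {K} x y (cs : List (ℚ × Rel K)) → (∀ v → eval v x - eval v y ≡ eval v (combine cs)) → x ≈[ K ] y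
≈-by-eval x y cs eval-x-y = cs , λ g →
  trans (coeff≡eval g (x ⊖ y)) (trans (eval-⊖ _ x y) (trans (eval-x-y _) (sym (coeff≡eval g (combine cs)))))

-- The weights of the combination

module Weights (m n : ℕ) (sign-N : sign (m ℕ.+ n) ≡ 1ℚ) where

  N : ℕ
  N = m ℕ.+ n

  T E : ℕ → ℚ
  T i = binom i m + binom i n
  E i = δ i m + δ i n

  -- γ l vanishes for even l; for odd l it is the coefficient of P[l+1, k-l-1; 0, 0] in the theorem.
  β γ : ℕ → ℚ
  β i = ½ * (sign i * T (N ∸ i) + δ i m)
  γ l = ½ * (1ℚ - sign l) * (T (N ∸ l) - δ l m)

  cZ cW : ℚ
  cZ = ½ * (binom (suc (suc N)) (suc n) + sign m)
  cW = ½ * (T 0 + binom N m)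

  δ-∸ : ∀ {i} → i ℕ.≤ N → δ (N ∸ i) m ≡ δ i n
  δ-∸ {i} i≤N with i ℕₚ.≟ n
  ... | yes refl = trans (cong (λ j → δ j m) (ℕₚ.m+n∸n≡m m n)) (trans (δ-self m) (sym (δ-self n)))
  ... | no  i≢n  = trans (δ-≢ N∸i≢m) (sym (δ-≢ i≢n))
    where
    N∸i≢m : N ∸ i ≢ m
    N∸i≢m N∸i≡m = i≢n (trans (sym (ℕₚ.m∸[m∸n]≡n i≤N)) (trans (cong (N ∸_) N∸i≡m) (ℕₚ.m+n∸m≡n m n)))

  β-∸ : ∀ {i} → i ℕ.≤ N → β (N ∸ i) ≡ ½ * (sign i * T i + δ i n)
  β-∸ i≤N rewrite sign-∸ sign-N i≤N | ℕₚ.m∸[m∸n]≡n i≤N | δ-∸ i≤N = refl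

  γ-∸ : ∀ {l} → l ℕ.≤ N → γ (N ∸ l) ≡ ½ * (1ℚ - sign l) * (T l - δ l n)
  γ-∸ l≤N rewrite sign-∸ sign-N l≤N | ℕₚ.m∸[m∸n]≡n l≤N | δ-∸ l≤N = refl

  β-pair : ∀ {i} → i ℕ.≤ N → β i + β (N ∸ i) ≡ ½ * (sign i * (T (N ∸ i) + T i) + E i)
  β-pair {i} i≤N = trans (cong (β i +_) (β-∸ i≤N))
    (solve 5 (λ s t t' d d' → con ½ :* (s :* t :+ d) :+ con ½ :* (s :* t' :+ d')
                            := con ½ :* (s :* (t :+ t') :+ (d :+ d'))) refl
           (sign i) (T (N ∸ i)) (T i) (δ i m) (δ i n))

  γ-pair : ∀ {l} → l ℕ.≤ N → γ l + γ (N ∸ l) ≡ ½ * (1ℚ - sign l) * (T (N ∸ l) + T l - E l)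
  γ-pair {l} l≤N = trans (cong (γ l +_) (γ-∸ l≤N))
    (solve 5 (λ s t t' d d' → con ½ :* (con 1ℚ :- s) :* (t :- d) :+ con ½ :* (con 1ℚ :- s) :* (t' :- d')
                            := con ½ :* (con 1ℚ :- s) :* (t :+ t' :- (d :+ d'))) refl
           (sign l) (T (N ∸ l)) (T l) (δ l m) (δ l n))

  γ-vanish : ∀ l → sign l ≡ 1ℚ → γ l ≡ 0ℚ
  γ-vanish l sign-l = trans (cong (λ s → ½ * (1ℚ - s) * (T (N ∸ l) - δ l m)) sign-l) (*-zeroˡ (T (N ∸ l) - δ l m))

  diff-T : ∀ l → diff l T ≡ sign l * E l
  diff-T l = begin
    diff l T                                    ≡⟨ diff-+ l _ _ ⟩
    diff l (λ i → binom i m) + diff l (λ i → binom i n) ≡⟨ cong₂ _+_ (diff-binom l m) (diff-binom l n) ⟩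
    sign m * δ l m + sign n * δ l n             ≡⟨ cong₂ _+_ (δ-transport sign l m) (δ-transport sign l n) ⟩
    sign l * δ l m + sign l * δ l n             ≡⟨ *-distribˡ-+ (sign l) _ _ ⟨
    sign l * E l                                ∎

  diff-T-∸ : ∀ {l} → l ℕ.≤ N → diff l (λ i → T (N ∸ i)) ≡ T (N ∸ l)
  diff-T-∸ {l} l≤N = begin
    diff l (λ i → T (N ∸ i))
      ≡⟨ diff-+ l _ _ ⟩
    diff l (λ i → binom (N ∸ i) m) + diff l (λ i → binom (N ∸ i) n)
      ≡⟨ cong₂ _+_ (diff-binom-reflect l N m n refl l≤N) (diff-binom-reflect l N n m (ℕₚ.+-comm n m) l≤N) ⟩
    binom (N ∸ l) n + binom (N ∸ l) m
      ≡⟨ +-comm (binom (N ∸ l) n) _ ⟩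
    T (N ∸ l)
      ∎

  ∑-T : ∑[ l < suc N ] T l ≡ binom (suc (suc N)) (suc n)
  ∑-T = begin
    ∑[ l < suc N ] T l                                        ≡⟨ ∑-+ (suc N) _ _ ⟩
    ∑[ l < suc N ] binom l m + ∑[ l < suc N ] binom l n       ≡⟨ cong₂ _+_ (hockey-stick N m) (hockey-stick N n) ⟩
    binom (suc N) (suc m) + binom (suc N) (suc n)             ≡⟨ cong (_+ binom (suc N) (suc n)) (binom-sym (suc m) n) ⟩
    binom (suc N) n + binom (suc N) (suc n)                   ≡⟨ binom-pascal (suc N) n ⟨
    binom (suc (suc N)) (suc n)                               ∎

  ∑-E-binom : ∀ l → ∑[ i < suc N ] E i * binom l i ≡ T l
  ∑-E-binom l = begin
    ∑[ i < suc N ] E i * binom l i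
      ≡⟨ ∑-cong (suc N) (λ i _ → *-distribʳ-+ (binom l i) (δ i m) (δ i n)) ⟩
    ∑[ i < suc N ] (δ i m * binom l i + δ i n * binom l i)
      ≡⟨ ∑-+ (suc N) _ _ ⟩
    ∑[ i < suc N ] δ i m * binom l i + ∑[ i < suc N ] δ i n * binom l i
      ≡⟨ cong₂ _+_ (∑-δ (binom l) (s≤s (ℕₚ.m≤m+n m n))) (∑-δ (binom l) (s≤s (ℕₚ.m≤n+m n m))) ⟩
    T l
      ∎

  ∑β-binom-pair : ∀ {l} → l ℕ.≤ N →
    ∑[ i < suc N ] β i * (binom l i + binom l (N ∸ i)) ≡ β l + β (N ∸ l) + (γ l + γ (N ∸ l))
  ∑β-binom-pair {l} l≤N = begin
    ∑[ i < suc N ] β i * (binom l i + binom l (N ∸ i))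
      ≡⟨ ∑-pair-reflect N β (binom l) ⟩
    ∑[ i < suc N ] (β i + β (N ∸ i)) * binom l i
      ≡⟨ ∑-cong (suc N) (λ i i≤N → split i (ℕₚ.≤-pred i≤N)) ⟩
    ∑[ i < suc N ] (½ * (sign i * binom l i * (T (N ∸ i) + T i)) + ½ * (E i * binom l i))
      ≡⟨ ∑-+ (suc N) _ _ ⟩
    ∑[ i < suc N ] ½ * (sign i * binom l i * (T (N ∸ i) + T i)) + ∑[ i < suc N ] ½ * (E i * binom l i)
      ≡⟨ cong₂ _+_ (∑-*ˡ (suc N) ½ _) (∑-*ˡ (suc N) ½ _) ⟩
    ½ * (∑[ i < suc N ] sign i * binom l i * (T (N ∸ i) + T i)) + ½ * (∑[ i < suc N ] E i * binom l i)
      ≡⟨ cong₂ (λ x y → ½ * x + ½ * y) (trans (diff-expansion l _ l≤N) (diff-+ l _ _)) (∑-E-binom l) ⟩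
    ½ * (diff l (λ i → T (N ∸ i)) + diff l T) + ½ * T l
      ≡⟨ cong₂ (λ x y → ½ * (x + y) + ½ * T l) (diff-T-∸ l≤N) (diff-T l) ⟩
    ½ * (T (N ∸ l) + sign l * E l) + ½ * T l
      ≡⟨ solve 4 (λ s t t' e → con ½ :* (t :+ s :* e) :+ con ½ :* t'
                   := con ½ :* (s :* (t :+ t') :+ e) :+ con ½ :* (con 1ℚ :- s) :* (t :+ t' :- e)) refl
               (sign l) (T (N ∸ l)) (T l) (E l) ⟩
    ½ * (sign l * (T (N ∸ l) + T l) + E l) + ½ * (1ℚ - sign l) * (T (N ∸ l) + T l - E l)
      ≡⟨ cong₂ _+_ (β-pair l≤N) (γ-pair l≤N) ⟨
    β l + β (N ∸ l) + (γ l + γ (N ∸ l))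
      ∎
    where
    split : ∀ i → i ℕ.≤ N → (β i + β (N ∸ i)) * binom l i
                          ≡ ½ * (sign i * binom l i * (T (N ∸ i) + T i)) + ½ * (E i * binom l i)
    split i i≤N = trans (cong (_* binom l i) (β-pair i≤N))
      (solve 4 (λ s b t e → con ½ :* (s :* t :+ e) :* b := con ½ :* (s :* b :* t) :+ con ½ :* (e :* b)) refl
             (sign i) (binom l i) (T (N ∸ i) + T i) (E i))

  ∑β+∑γ : ∑[ l < suc N ] β l + ∑[ l < suc N ] γ l ≡ cZ
  ∑β+∑γ = begin
    ∑[ l < suc N ] β l + ∑[ l < suc N ] γ l
      ≡⟨ ∑-+ (suc N) β γ ⟨
    ∑[ l < suc N ] (β l + γ l)
      ≡⟨ ∑-cong (suc N) (λ l _ → β+γ l) ⟩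
    ∑[ l < suc N ] (½ * T (N ∸ l) + ½ * (δ l m * sign l))
      ≡⟨ ∑-+ (suc N) _ _ ⟩
    ∑[ l < suc N ] ½ * T (N ∸ l) + ∑[ l < suc N ] ½ * (δ l m * sign l)
      ≡⟨ cong₂ _+_ (∑-*ˡ (suc N) ½ _) (∑-*ˡ (suc N) ½ _) ⟩
    ½ * (∑[ l < suc N ] T (N ∸ l)) + ½ * (∑[ l < suc N ] δ l m * sign l)
      ≡⟨ cong₂ (λ x y → ½ * x + ½ * y) (trans (∑-reflect N T) ∑-T) (∑-δ sign (s≤s (ℕₚ.m≤m+n m n))) ⟩
    ½ * binom (suc (suc N)) (suc n) + ½ * sign m
      ≡⟨ *-distribˡ-+ ½ (binom (suc (suc N)) (suc n)) (sign m) ⟨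
    cZ
      ∎
    where
    β+γ : ∀ l → β l + γ l ≡ ½ * T (N ∸ l) + ½ * (δ l m * sign l)
    β+γ l = solve 3 (λ s t d → con ½ :* (s :* t :+ d) :+ con ½ :* (con 1ℚ :- s) :* (t :- d)
                             := con ½ :* t :+ con ½ :* (d :* s)) refl (sign l) (T (N ∸ l)) (δ l m)

  ∑β-binom : ∑[ i < suc N ] β i * binom N i ≡ cW
  ∑β-binom = begin
    ∑[ i < suc N ] β i * binom N i
      ≡⟨ ∑-cong (suc N) (λ i _ → split i) ⟩
    ∑[ i < suc N ] (½ * (sign i * binom N i * T (N ∸ i)) + ½ * (δ i m * binom N i))
      ≡⟨ ∑-+ (suc N) _ _ ⟩
    ∑[ i < suc N ] ½ * (sign i * binom N i * T (N ∸ i)) + ∑[ i < suc N ] ½ * (δ i m * binom N i)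
      ≡⟨ cong₂ _+_ (∑-*ˡ (suc N) ½ _) (∑-*ˡ (suc N) ½ _) ⟩
    ½ * (∑[ i < suc N ] sign i * binom N i * T (N ∸ i)) + ½ * (∑[ i < suc N ] δ i m * binom N i)
      ≡⟨ cong₂ (λ x y → ½ * x + ½ * y) (trans (diff-expansion N _ ℕₚ.≤-refl) (diff-T-∸ ℕₚ.≤-refl))
                                       (∑-δ (binom N) (s≤s (ℕₚ.m≤m+n m n))) ⟩
    ½ * T (N ∸ N) + ½ * binom N m
      ≡⟨ cong (λ j → ½ * T j + ½ * binom N m) (ℕₚ.n∸n≡0 N) ⟩
    ½ * T 0 + ½ * binom N m
      ≡⟨ *-distribˡ-+ ½ (T 0) (binom N m) ⟨
    ½ * (T 0 + binom N m)
      ∎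
    where
    split : ∀ i → β i * binom N i ≡ ½ * (sign i * binom N i * T (N ∸ i)) + ½ * (δ i m * binom N i)
    split i = solve 4 (λ s b t d → con ½ :* (s :* t :+ d) :* b := con ½ :* (s :* b :* t) :+ con ½ :* (d :* b)) refl
                      (sign i) (binom N i) (T (N ∸ i)) (δ i m)

  module LinearForms (Z W : ℚ) (H P′ : ℕ → ℚ) where

    -- The values of the shuffle relation with k₁ = i + 1 and of the P relation with k₁ = l + 1 under a valuation
    -- sending G[k;0], G[k-1;1], G[l+1,k-l-1;0,0] and P[l+1,k-l-1;0,0] to Z, W, H l and P′ l.
    shuffleForm stuffleForm : ℕ → ℚ
    shuffleForm i = H i + H (N ∸ i) + Z - (∑[ l < suc N ] (binom l i + binom l (N ∸ i)) * H l + binom N i * W)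
    stuffleForm l = P′ l - (H l + H (N ∸ l) + Z)

    Hβ Hγ : ℚ
    Hβ = ∑[ l < suc N ] (β l + β (N ∸ l)) * H l
    Hγ = ∑[ l < suc N ] (γ l + γ (N ∸ l)) * H l

    ∑β-shuffleForm : ∑[ i < suc N ] β i * shuffleForm i ≡ Hβ + ∑< (suc N) β * Z - (Hβ + Hγ + cW * W)
    ∑β-shuffleForm = begin
      ∑[ i < suc N ] β i * shuffleForm i
        ≡⟨ ∑-cong (suc N) (λ i _ → expand i) ⟩
      ∑[ i < suc N ] (β i * (H i + H (N ∸ i)) + β i * Z - (β i * S i + β i * binom N i * W))
        ≡⟨ ∑-- (suc N) _ _ ⟩
      ∑[ i < suc N ] (β i * (H i + H (N ∸ i)) + β i * Z) - ∑[ i < suc N ] (β i * S i + β i * binom N i * W)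
        ≡⟨ cong₂ _-_ (∑-+ (suc N) _ _) (∑-+ (suc N) _ _) ⟩
      ∑[ i < suc N ] β i * (H i + H (N ∸ i)) + ∑[ i < suc N ] β i * Z
        - (∑[ i < suc N ] β i * S i + ∑[ i < suc N ] β i * binom N i * W)
        ≡⟨ cong₂ _-_ (cong₂ _+_ (∑-pair-reflect N β H) (∑-*ʳ (suc N) Z β))
                     (cong₂ _+_ ∑βS (trans (∑-*ʳ (suc N) W _) (cong (_* W) ∑β-binom))) ⟩
      Hβ + ∑< (suc N) β * Z - (Hβ + Hγ + cW * W)
        ∎
      where
      S : ℕ → ℚ
      S i = ∑[ l < suc N ] (binom l i + binom l (N ∸ i)) * H l

      expand : ∀ i → β i * shuffleForm i ≡ β i * (H i + H (N ∸ i)) + β i * Z - (β i * S i + β i * binom N i * W)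
      expand i = solve 7 (λ b x y z s c w → b :* (x :+ y :+ z :- (s :+ c :* w))
                                          := b :* (x :+ y) :+ b :* z :- (b :* s :+ b :* c :* w)) refl
                         (β i) (H i) (H (N ∸ i)) Z (S i) (binom N i) W

      ∑βS : ∑[ i < suc N ] β i * S i ≡ Hβ + Hγ
      ∑βS = begin
        ∑[ i < suc N ] β i * S i
          ≡⟨ ∑-*-∑ (suc N) (suc N) β (λ l i → binom l i + binom l (N ∸ i)) H ⟩
        ∑[ l < suc N ] (∑[ i < suc N ] β i * (binom l i + binom l (N ∸ i))) * H l
          ≡⟨ ∑-cong (suc N) (λ l l≤N → cong (_* H l) (∑β-binom-pair (ℕₚ.≤-pred l≤N))) ⟩
        ∑[ l < suc N ] (β l + β (N ∸ l) + (γ l + γ (N ∸ l))) * H l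
          ≡⟨ ∑-cong (suc N) (λ l _ → *-distribʳ-+ (H l) (β l + β (N ∸ l)) (γ l + γ (N ∸ l))) ⟩
        ∑[ l < suc N ] ((β l + β (N ∸ l)) * H l + (γ l + γ (N ∸ l)) * H l)
          ≡⟨ ∑-+ (suc N) _ _ ⟩
        Hβ + Hγ
          ∎

    ∑γ-stuffleForm : ∑[ l < suc N ] - γ l * stuffleForm l ≡ Hγ + ∑< (suc N) γ * Z - ∑[ l < suc N ] γ l * P′ l
    ∑γ-stuffleForm = begin
      ∑[ l < suc N ] - γ l * stuffleForm l
        ≡⟨ ∑-cong (suc N) (λ l _ → expand l) ⟩
      ∑[ l < suc N ] (γ l * (H l + H (N ∸ l)) + γ l * Z - γ l * P′ l)
        ≡⟨ ∑-- (suc N) _ _ ⟩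
      ∑[ l < suc N ] (γ l * (H l + H (N ∸ l)) + γ l * Z) - ∑[ l < suc N ] γ l * P′ l
        ≡⟨ cong (_- ∑[ l < suc N ] γ l * P′ l) (∑-+ (suc N) _ _) ⟩
      ∑[ l < suc N ] γ l * (H l + H (N ∸ l)) + ∑[ l < suc N ] γ l * Z - ∑[ l < suc N ] γ l * P′ l
        ≡⟨ cong (_- ∑[ l < suc N ] γ l * P′ l) (cong₂ _+_ (∑-pair-reflect N γ H) (∑-*ʳ (suc N) Z γ)) ⟩
      Hγ + ∑< (suc N) γ * Z - ∑[ l < suc N ] γ l * P′ l
        ∎
      where
      expand : ∀ l → - γ l * stuffleForm l ≡ γ l * (H l + H (N ∸ l)) + γ l * Z - γ l * P′ l
      expand l = solve 5 (λ g p x y z → (:- g) :* (p :- (x :+ y :+ z)) := g :* (x :+ y) :+ g :* z :- g :* p) refl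
                         (γ l) (P′ l) (H l) (H (N ∸ l)) Z

    relation-combination :
      ∑[ i < suc N ] β i * shuffleForm i + ∑[ l < suc N ] - γ l * stuffleForm l
        ≡ cZ * Z - (∑[ l < suc N ] γ l * P′ l + cW * W)
    relation-combination = begin
      ∑[ i < suc N ] β i * shuffleForm i + ∑[ l < suc N ] - γ l * stuffleForm l
        ≡⟨ cong₂ _+_ ∑β-shuffleForm ∑γ-stuffleForm ⟩
      Hβ + ∑< (suc N) β * Z - (Hβ + Hγ + cW * W) + (Hγ + ∑< (suc N) γ * Z - ∑[ l < suc N ] γ l * P′ l)
        ≡⟨ solve 7 (λ hb hg sb sg z w sp → hb :+ sb :* z :- (hb :+ hg :+ w) :+ (hg :+ sg :* z :- sp)
                                         := (sb :+ sg) :* z :- (sp :+ w)) refl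
                   Hβ Hγ (∑< (suc N) β) (∑< (suc N) γ) Z (cW * W) (∑[ l < suc N ] γ l * P′ l) ⟩
      (∑< (suc N) β + ∑< (suc N) γ) * Z - (∑[ l < suc N ] γ l * P′ l + cW * W)
        ≡⟨ cong (λ c → c * Z - (∑[ l < suc N ] γ l * P′ l + cW * W)) ∑β+∑γ ⟩
      cZ * Z - (∑[ l < suc N ] γ l * P′ l + cW * W)
        ∎

module DoubleShuffle (m n : ℕ) (sign-N : sign (m ℕ.+ n) ≡ 1ℚ) (1≤N : 1 ℕ.≤ m ℕ.+ n) where
  open Weights m n sign-N

  K : ℕ
  K = suc m ℕ.+ suc n

  K≡2+N : K ≡ suc (suc N)
  K≡2+N = cong suc (ℕₚ.+-suc m n)

  K∸suc : ∀ {i} → i ℕ.≤ N → K ∸ suc i ≡ suc (N ∸ i)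
  K∸suc {i} i≤N = trans (cong (_∸ suc i) K≡2+N) (ℕₚ.+-∸-assoc 1 i≤N)

  weight : ∀ {a} → a ℕ.≤ N → suc a ℕ.+ suc (N ∸ a) ≡ K
  weight {a} a≤N = trans (cong suc (ℕₚ.+-suc a (N ∸ a))) (trans (cong (suc ∘ suc) (ℕₚ.m+[n∸m]≡n a≤N)) (sym K≡2+N))

  weight₀ : ∀ {a} → a ℕ.≤ N → suc a ℕ.+ suc (N ∸ a) ℕ.+ 0 ℕ.+ 0 ≡ K
  weight₀ a≤N = trans (ℕₚ.+-identityʳ _) (trans (ℕₚ.+-identityʳ _) (weight a≤N))

  -- The index is clamped to i ⊓ N so that a relation exists for every i; only i ≤ N is ever used.
  shuffleRel stuffleRel : ℕ → Rel K
  shuffleRel i = relSh (suc (i ℕ.⊓ N)) (suc (N ∸ (i ℕ.⊓ N))) 0 0 (s≤s z≤n) (s≤s z≤n) (weight₀ (ℕₚ.m⊓n≤n i N))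
  stuffleRel l = relP  (suc (l ℕ.⊓ N)) (suc (N ∸ (l ℕ.⊓ N))) 0 0 (s≤s z≤n) (s≤s z≤n) (weight₀ (ℕₚ.m⊓n≤n l N))

  combination : List (ℚ × Rel K)
  combination = map (λ i → β i , shuffleRel i) (upTo (suc N)) ++ map (λ l → - γ l , stuffleRel l) (upTo (suc N))

  module _ (v : Gen → ℚ) where

    Z W : ℚ
    Z = v (G1 K 0)
    W = v (G1 (K ∸ 1) 1)

    H P′ : ℕ → ℚ
    H  l = v (G2 (suc l) (K ∸ suc l) 0 0)
    P′ l = v (P (suc l) (K ∸ suc l) 0 0)

    open LinearForms Z W H P′

    H-at : ∀ {a} → a ℕ.≤ N → v (G2 (suc a) (suc (N ∸ a)) 0 0) ≡ H a
    H-at {a} a≤N = cong (λ k → v (G2 (suc a) k 0 0)) (sym (K∸suc a≤N))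

    H-at-∸ : ∀ {a} → a ℕ.≤ N → v (G2 (suc (N ∸ a)) (suc a) 0 0) ≡ H (N ∸ a)
    H-at-∸ {a} a≤N = cong (λ k → v (G2 (suc (N ∸ a)) k 0 0))
                          (sym (trans (K∸suc (ℕₚ.m∸n≤m N a)) (cong suc (ℕₚ.m∸[m∸n]≡n a≤N))))

    eval-shuffleRel : ∀ {i} → i ℕ.≤ N → eval v (relLC (shuffleRel i)) ≡ shuffleForm i
    eval-shuffleRel {i} i≤N = trans (unclamped (ℕₚ.m⊓n≤n i N)) (cong shuffleForm (ℕₚ.m≤n⇒m⊓n≡m i≤N))
      where
      unclamped : ∀ {a} → a ℕ.≤ N →
        eval v (stuffle (suc a) (suc (N ∸ a)) 0 0 ⊖ shuffle (suc a) (suc (N ∸ a)) 0 0) ≡ shuffleForm a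
      unclamped {a} a≤N = trans (eval-shuffleRelation v (weight a≤N))
        (cong₂ _-_
          (cong₂ (λ h h' → h + h' + Z) (H-at a≤N) (H-at-∸ a≤N))
          (cong₂ (λ k k' → ∑< k (λ l → (binom l a + binom l (N ∸ a)) * H l) + binom k' a * W)
                 (cong (_∸ 1) K≡2+N) (cong (_∸ 2) K≡2+N)))

    eval-stuffleRel : ∀ {l} → l ℕ.≤ N → eval v (relLC (stuffleRel l)) ≡ stuffleForm l
    eval-stuffleRel {l} l≤N = trans (unclamped (ℕₚ.m⊓n≤n l N)) (cong stuffleForm (ℕₚ.m≤n⇒m⊓n≡m l≤N))
      where
      unclamped : ∀ {a} → a ℕ.≤ N →
        eval v (((1ℚ , P (suc a) (suc (N ∸ a)) 0 0) ∷ []) ⊖ stuffle (suc a) (suc (N ∸ a)) 0 0) ≡ stuffleForm a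
      unclamped {a} a≤N = trans (eval-stuffleRelation v (suc a) (suc (N ∸ a)))
        (cong₂ _-_ (cong (λ k → v (P (suc a) k 0 0)) (sym (K∸suc a≤N)))
                   (cong₂ _+_ (cong₂ _+_ (H-at a≤N) (H-at-∸ a≤N)) (cong (λ k → v (G1 k 0)) (weight a≤N))))

    eval-combination :
      eval v (combine combination) ≡ ∑[ i < suc N ] β i * shuffleForm i + ∑[ l < suc N ] - γ l * stuffleForm l
    eval-combination = begin
      eval v (combine combination)
        ≡⟨ eval-combine v combination ⟩
      sumL (evalTerm v) combination
        ≡⟨ sumL-++ (evalTerm v) (map (λ i → β i , shuffleRel i) (upTo (suc N))) _ ⟩
      sumL (evalTerm v) (map (λ i → β i , shuffleRel i) (upTo (suc N)))
        + sumL (evalTerm v) (map (λ l → - γ l , stuffleRel l) (upTo (suc N)))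
        ≡⟨ cong₂ _+_ (weighted β shuffleRel shuffleForm eval-shuffleRel)
                     (weighted (λ l → - γ l) stuffleRel stuffleForm eval-stuffleRel) ⟩
      ∑[ i < suc N ] β i * shuffleForm i + ∑[ l < suc N ] - γ l * stuffleForm l
        ∎
      where
      weighted : ∀ (c : ℕ → ℚ) (r : ℕ → Rel K) (form : ℕ → ℚ) → (∀ {i} → i ℕ.≤ N → eval v (relLC (r i)) ≡ form i) →
        sumL (evalTerm v) (map (λ i → c i , r i) (upTo (suc N))) ≡ ∑[ i < suc N ] c i * form i
      weighted c r form eval-r = trans (sumL-map (evalTerm v) (λ i → c i , r i) (upTo (suc N)))
        (trans (sumL-upTo _ (suc N)) (∑-cong (suc N) λ i i≤N → cong (c i *_) (eval-r (ℕₚ.≤-pred i≤N))))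

    eval-thmLHS : eval v (thmLHS (suc m) (suc n)) ≡ cZ * Z
    eval-thmLHS = trans (+-identityʳ _) (cong (_* Z) (cong (½ *_) (cong₂ _+_ top-binom top-sign)))
      where
      top-binom : ℕ→ℚ (K C suc n) ≡ binom (suc (suc N)) (suc n)
      top-binom = cong (λ k → binom k (suc n)) K≡2+N
      top-sign : - sgn (suc m) ≡ sign m
      top-sign = trans (cong -_ (sgn≡sign (suc m))) (neg-involutive (sign m))

    eval-thmRHS : eval v (thmRHS (suc m) (suc n)) ≡ ∑[ l < suc N ] γ l * P′ l + cW * W
    eval-thmRHS = trans (eval-++ v (map (λ j → cP j , P j (K ∸ j) 0 0) evens) _)
                        (cong₂ _+_ P-part (trans (+-identityʳ _) (cong (_* W) W-coefficient)))
      where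
      evens : List ℕ
      evens = filterᵇ (λ j → j % 2 ≡ᵇ 0) (map (2 ℕ.+_) (upTo (K ∸ 3)))

      K∸3≡N∸1 : K ∸ 3 ≡ N ∸ 1
      K∸3≡N∸1 = cong (_∸ 3) K≡2+N

      N≡1+[N∸1] : N ≡ suc (N ∸ 1)
      N≡1+[N∸1] = sym (ℕₚ.m+[n∸m]≡n 1≤N)

      W-coefficient : ½ * (ℕ→ℚ ((K ∸ 3) C m) + ℕ→ℚ ((K ∸ 3) C n) + δ (suc m) 1 + δ (suc n) 1) ≡ cW
      W-coefficient = begin
        ½ * (binom (K ∸ 3) m + binom (K ∸ 3) n + δ m 0 + δ n 0)
          ≡⟨ cong (λ k → ½ * (binom k m + binom k n + δ m 0 + δ n 0)) K∸3≡N∸1 ⟩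
        ½ * (binom (N ∸ 1) m + binom (N ∸ 1) n + δ m 0 + δ n 0)
          ≡⟨ cong₂ (λ x y → ½ * (binom (N ∸ 1) m + binom (N ∸ 1) n + x + y)) (binom0≡δ m) (binom0≡δ n) ⟨
        ½ * (binom (N ∸ 1) m + binom (N ∸ 1) n + binom 0 m + binom 0 n)
          ≡⟨ cong (λ x → ½ * (x + binom 0 m + binom 0 n)) (binom-pred-pair m n 1≤N) ⟩
        ½ * (binom N m + binom 0 m + binom 0 n)
          ≡⟨ cong (½ *_) (trans (+-assoc (binom N m) _ _) (+-comm (binom N m) (T 0))) ⟩
        cW
          ∎

      cP summand even-summand : ℕ → ℚ
      cP j = ℕ→ℚ ((K ∸ j ∸ 1) C m) + ℕ→ℚ ((K ∸ j ∸ 1) C n) - δ j (suc m)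
      summand j = cP j * v (P j (K ∸ j) 0 0)
      even-summand t = if (2 ℕ.+ t) % 2 ≡ᵇ 0 then summand (2 ℕ.+ t) else 0ℚ

      P-term : ∀ t → suc t ℕ.≤ N → even-summand t ≡ γ (suc t) * P′ (suc t)
      P-term t 1+t≤N = begin
        even-summand t ≡⟨ if-even t (summand (2 ℕ.+ t)) ⟩
        ½ * (1ℚ + sign t) * ((binom (K ∸ suc (suc t) ∸ 1) m + binom (K ∸ suc (suc t) ∸ 1) n - δ (suc t) m) * P′ (suc t))
          ≡⟨ cong (λ k → ½ * (1ℚ + sign t) * ((binom k m + binom k n - δ (suc t) m) * P′ (suc t)))
                  (cong (_∸ 1) (K∸suc 1+t≤N)) ⟩
        ½ * (1ℚ + sign t) * ((T (N ∸ suc t) - δ (suc t) m) * P′ (suc t))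
          ≡⟨ solve 3 (λ s x p → con ½ :* (con 1ℚ :+ s) :* (x :* p) := con ½ :* (con 1ℚ :- :- s) :* x :* p) refl
                     (sign t) (T (N ∸ suc t) - δ (suc t) m) (P′ (suc t)) ⟩
        γ (suc t) * P′ (suc t)
          ∎

      γP′-vanish : ∀ l → sign l ≡ 1ℚ → γ l * P′ l ≡ 0ℚ
      γP′-vanish l sign-l = trans (cong (_* P′ l) (γ-vanish l sign-l)) (*-zeroˡ (P′ l))

      P-part : eval v (map (λ j → cP j , P j (K ∸ j) 0 0) evens) ≡ ∑[ l < suc N ] γ l * P′ l
      P-part = begin
        eval v (map (λ j → cP j , P j (K ∸ j) 0 0) evens)
          ≡⟨ eval-map v (λ j → cP j , P j (K ∸ j) 0 0) evens ⟩
        sumL summand evens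
          ≡⟨ sumL-filterᵇ summand (λ j → j % 2 ≡ᵇ 0) (map (2 ℕ.+_) (upTo (K ∸ 3))) ⟩
        sumL (λ j → if j % 2 ≡ᵇ 0 then summand j else 0ℚ) (map (2 ℕ.+_) (upTo (K ∸ 3)))
          ≡⟨ sumL-map (λ j → if j % 2 ≡ᵇ 0 then summand j else 0ℚ) (2 ℕ.+_) (upTo (K ∸ 3)) ⟩
        sumL even-summand (upTo (K ∸ 3))
          ≡⟨ sumL-upTo even-summand (K ∸ 3) ⟩
        ∑< (K ∸ 3) even-summand
          ≡⟨ cong (λ k → ∑< k even-summand) K∸3≡N∸1 ⟩
        ∑< (N ∸ 1) even-summand
          ≡⟨ ∑-cong (N ∸ 1) (λ t t<N∸1 → P-term t (ℕₚ.≤-trans t<N∸1 (ℕₚ.m∸n≤m N 1))) ⟩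
        ∑[ t < N ∸ 1 ] γ (suc t) * P′ (suc t)
          ≡⟨ ∑-drop-ends (N ∸ 1) (λ l → γ l * P′ l)
                         (γP′-vanish 0 refl) (γP′-vanish (suc (N ∸ 1)) (subst (λ j → sign j ≡ 1ℚ) N≡1+[N∸1] sign-N)) ⟨
        ∑< (suc (suc (N ∸ 1))) (λ l → γ l * P′ l)
          ≡⟨ cong (λ k → ∑< (suc k) (λ l → γ l * P′ l)) N≡1+[N∸1] ⟨
        ∑[ l < suc N ] γ l * P′ l
          ∎

    relation-combination-eval :
      eval v (thmLHS (suc m) (suc n)) - eval v (thmRHS (suc m) (suc n)) ≡ eval v (combine combination)
    relation-combination-eval = begin
      eval v (thmLHS (suc m) (suc n)) - eval v (thmRHS (suc m) (suc n))
        ≡⟨ cong₂ _-_ eval-thmLHS eval-thmRHS ⟩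
      cZ * Z - (∑[ l < suc N ] γ l * P′ l + cW * W)
        ≡⟨ relation-combination ⟨
      ∑[ i < suc N ] β i * shuffleForm i + ∑[ l < suc N ] - γ l * stuffleForm l
        ≡⟨ eval-combination ⟨
      eval v (combine combination)
        ∎

  thmLHS≈thmRHS : thmLHS (suc m) (suc n) ≈[ K ] thmRHS (suc m) (suc n)
  thmLHS≈thmRHS = ≈-by-eval (thmLHS (suc m) (suc n)) (thmRHS (suc m) (suc n)) combination relation-combination-eval

theorem4p4 : (k₁ k₂ : ℕ) → 1 ℕ.≤ k₁ → 1 ℕ.≤ k₂ → 4 ℕ.≤ k₁ ℕ.+ k₂ → 2 ∣ (k₁ ℕ.+ k₂) →
    thmLHS k₁ k₂ ≈[ k₁ ℕ.+ k₂ ] thmRHS k₁ k₂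
theorem4p4 (suc m) (suc n) _ _ 4≤K (divides q K≡q*2) = DoubleShuffle.thmLHS≈thmRHS m n sign-N 1≤N
  where
  K≡2+N : suc m ℕ.+ suc n ≡ suc (suc (m ℕ.+ n))
  K≡2+N = cong suc (ℕₚ.+-suc m n)
  sign-N : sign (m ℕ.+ n) ≡ 1ℚ
  sign-N = begin
    sign (m ℕ.+ n)                 ≡⟨ neg-involutive (sign (m ℕ.+ n)) ⟨
    sign (suc (suc (m ℕ.+ n)))     ≡⟨ cong sign (trans (sym K≡2+N) K≡q*2) ⟩
    sign (q ℕ.* 2)                 ≡⟨ sign-double q ⟩
    1ℚ                             ∎
  1≤N : 1 ℕ.≤ m ℕ.+ n
  1≤N = ℕₚ.≤-trans (s≤s z≤n) (ℕₚ.≤-pred (ℕₚ.≤-pred (subst (4 ℕ.≤_) K≡2+N 4≤K)))
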